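{- Let ${\cal M}$ and ${\cal M}'$ be matchings of a graph $G$. Consider the following process: initialize ${\cal M}^*={\cal M}$; while ${\cal M}'\setminus{\cal M}^*\neq\emptyset$, choose an edge $e\in{\cal M}'\setminus{\cal M}^*$, where a good edge is chosen whenever one exists (a bad edge is chosen only if no good edge exists), add $e$ to ${\cal M}^*$, and remove from ${\cal M}^*$ the (at most two) other edges of ${\cal M}^*$ sharing an endpoint with $e$. Here an edge of ${\cal M}'\setminus{\cal M}^*$ is good if it shares an endpoint with at most one edge of ${\cal M}^*$, and bad if it shares an endpoint with two edges of ${\cal M}^*$. Then at every moment of this process (after each complete addition-and-removal step), $|{\cal M}^*|\ge\min\{|{\cal M}|,|{\cal M}'|-1\}$. -}

module Defs where

open import Data.Nat using (ℕ)
open import Data.Fin using (Fin)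
open import Data.Fin.Subset using (Subset; _∈_; _∉_)
open import Data.Product using (_×_; proj₁; proj₂; ∃-syntax; _,_)
open import Data.Sum using (_⊎_)
open import Data.Empty using (⊥)
open import Relation.Binary.PropositionalEquality using (_≡_; _≢_)
open import Relation.Binary.Construct.Closure.ReflexiveTransitive using (Star)
open import Function.Bundles using (_⇔_)

record Graph : Set where
  field
    n m   : ℕ
    ends  : Fin m → Fin n × Fin n
    loopless : ∀ e → proj₁ (ends e) ≢ proj₂ (ends e)
    simple   : ∀ e f →
      ((proj₁ (ends e) ≡ proj₁ (ends f) × proj₂ (ends e) ≡ proj₂ (ends f)) ⊎
       (proj₁ (ends e) ≡ proj₂ (ends f) × proj₂ (ends e) ≡ proj₁ (ends f))) →
      e ≡ f

module _ (G : Graph) where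
  open Graph G

  Edge : Set
  Edge = Fin m

  EdgeSet : Set
  EdgeSet = Subset m

  Shares : Edge → Edge → Set
  Shares e f =
    (proj₁ (ends e) ≡ proj₁ (ends f)) ⊎ (proj₁ (ends e) ≡ proj₂ (ends f)) ⊎
    (proj₂ (ends e) ≡ proj₁ (ends f)) ⊎ (proj₂ (ends e) ≡ proj₂ (ends f))

  IsMatching : EdgeSet → Set
  IsMatching S = ∀ e f → e ∈ S → f ∈ S → e ≢ f → Shares e f → ⊥

  Good : EdgeSet → Edge → Set
  Good S e = ∀ f g → f ∈ S → g ∈ S → Shares e f → Shares e g → f ≡ g

  Step : EdgeSet → EdgeSet → EdgeSet → Set
  Step M' S T = ∃[ e ] (e ∈ M' × e ∉ S
      × ((∃[ g ] (g ∈ M' × g ∉ S × Good S g)) → Good S e)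
      × (∀ f → f ∈ T ⇔ (f ≡ e ⊎ (f ∈ S × (Shares e f → ⊥)))))

  Reachable : EdgeSet → EdgeSet → EdgeSet → Set
  Reachable M' M S = Star (Step M') M S

module Submission where

-- Write c for the number of edges of M* sharing an endpoint with the
-- inserted edge e.  Then |T| + c = |M*| + 1 for the new set T, and c ≤ 2
-- because M* is a matching; also T is again a matching.  If c ≤ 1 the step
-- does not shrink M*.  If c = 2 then e is bad, so by the choice rule every
-- edge of M' ∖ M* is bad.  Then every vertex covered by an edge of M' ∖ M*
-- is also covered by an edge of M* ∖ M', and double counting the pairs
-- (edge, endpoint) gives |M' ∖ M*| ≤ |M* ∖ M'|, i.e. |M'| ≤ |M*|; hence
-- |T| = |M*| - 1 ≥ |M'| - 1.  By induction along the process, every M*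
-- is a matching of size at least min(|M|, |M'| - 1).

open import Defs
open import Data.Nat using (ℕ; zero; suc; _+_; _*_; _≤_; _≥_; _⊓_; _∸_; z≤n; s≤s)
open import Data.Nat.Properties
  using ( module ≤-Reasoning; ≤-trans; ≤-antisym; ≤-reflexive; m≤m+n; m≤n+m; +-mono-≤; _≤?_
        ; *-cancelˡ-≤; m+n∸n≡m; ∸-monoʳ-≤; ∸-monoˡ-≤; m⊓n≤m; m⊓n≤n; +-*-semiring)
open import Data.Fin using (Fin; zero; suc)
open import Data.Fin.Properties using (suc-injective; any?) renaming (_≟_ to _≟ᶠ_)
open import Data.Fin.Subset using (Subset; _∈_; _∉_; ∣_∣; inside; outside)
open import Data.Fin.Subset.Properties using (_∈?_)
open import Data.Vec using (_∷_; []; there)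
open import Data.Product using (_×_; _,_; proj₁; proj₂; swap; ∃-syntax)
open import Data.Sum using (_⊎_; inj₁; inj₂; [_,_]′) renaming (map to ⊎-map)
open import Data.Empty using (⊥; ⊥-elim)
open import Relation.Nullary using (Dec; yes; no; ¬_)
open import Relation.Nullary.Decidable using (_×-dec_; _⊎-dec_; ¬?)
open import Relation.Binary.PropositionalEquality using (_≡_; _≢_; refl; sym; trans; cong; cong₂; subst; module ≡-Reasoning)
open import Function.Base using (_∘_; id)
open import Level using (Level)
open import Relation.Binary.Construct.Closure.ReflexiveTransitive using (Star; ε; _◅_)
open import Function.Bundles using (_⇔_; Equivalence)
open import Algebra.Properties.Semiring.Sum +-*-semiring using (sum; ∑-distrib-+; ∑-comm; *-distribˡ-sum; sum-cong-≗; sum-replicate-zero)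

𝟙 : ∀ {p} {P : Set p} → Dec P → ℕ
𝟙 (yes _) = 1
𝟙 (no _)  = 0

count : ∀ {k p} {P : Fin k → Set p} → (∀ i → Dec (P i)) → ℕ
count P? = sum (λ i → 𝟙 (P? i))

∑-mono : ∀ {k} {f g : Fin k → ℕ} → (∀ i → f i ≤ g i) → sum f ≤ sum g
∑-mono {zero}  f≤g = z≤n
∑-mono {suc k} f≤g = +-mono-≤ (f≤g zero) (∑-mono (λ i → f≤g (suc i)))

∑-term : ∀ {k} (f : Fin k → ℕ) i → f i ≤ sum f
∑-term f zero    = m≤m+n _ _
∑-term f (suc i) = ≤-trans (∑-term (λ j → f (suc j)) i) (m≤n+m _ _)

𝟙-mono : ∀ {p q} {P : Set p} {Q : Set q} (P? : Dec P) (Q? : Dec Q) → (P → Q) → 𝟙 P? ≤ 𝟙 Q?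
𝟙-mono (yes p) (no ¬q) P⇒Q = ⊥-elim (¬q (P⇒Q p))
𝟙-mono (yes _) (yes _) _   = s≤s z≤n
𝟙-mono (no _)  _       _   = z≤n

count-mono : ∀ {k p q} {P : Fin k → Set p} {Q : Fin k → Set q} (P? : ∀ i → Dec (P i)) (Q? : ∀ i → Dec (Q i)) →
  (∀ {i} → P i → Q i) → count P? ≤ count Q?
count-mono P? Q? P⇒Q = ∑-mono (λ i → 𝟙-mono (P? i) (Q? i) P⇒Q)

module _ {k : ℕ} {p q : Level} {P : Fin k → Set p} {Q : Fin k → Set q}
         (P? : ∀ i → Dec (P i)) (Q? : ∀ i → Dec (Q i)) where

  count-cong : (∀ {i} → P i → Q i) → (∀ {i} → Q i → P i) → count P? ≡ count Q?
  count-cong P⇒Q Q⇒P = ≤-antisym (count-mono P? Q? P⇒Q) (count-mono Q? P? Q⇒P)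

  count-partition : ∀ {r} {R : Fin k → Set r} (R? : ∀ i → Dec (R i)) →
    (∀ {i} → R i → P i ⊎ Q i) → (∀ {i} → P i ⊎ Q i → R i) → (∀ {i} → P i → ¬ Q i) →
    count R? ≡ count P? + count Q?
  count-partition R? R⇒P⊎Q P⊎Q⇒R disjoint =
    trans (sum-cong-≗ indicator-split) (∑-distrib-+ (λ i → 𝟙 (P? i)) (λ i → 𝟙 (Q? i)))
    where
    indicator-split : ∀ i → 𝟙 (R? i) ≡ 𝟙 (P? i) + 𝟙 (Q? i)
    indicator-split i with R? i | P? i | Q? i
    ... | _      | yes pi | yes qi = ⊥-elim (disjoint pi qi)
    ... | yes _  | yes _  | no _   = refl
    ... | yes _  | no _   | yes _  = refl
    ... | yes ri | no ¬pi | no ¬qi with R⇒P⊎Q ri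
    ...   | inj₁ pi = ⊥-elim (¬pi pi)
    ...   | inj₂ qi = ⊥-elim (¬qi qi)
    indicator-split i | no ¬ri | yes pi | no _   = ⊥-elim (¬ri (P⊎Q⇒R (inj₁ pi)))
    indicator-split i | no ¬ri | no _   | yes qi = ⊥-elim (¬ri (P⊎Q⇒R (inj₂ qi)))
    indicator-split i | no _   | no _   | no _   = refl

  count-subadditive : ∀ {r} {R : Fin k → Set r} (R? : ∀ i → Dec (R i)) →
    (∀ {i} → R i → P i ⊎ Q i) → count R? ≤ count P? + count Q?
  count-subadditive R? R⇒P⊎Q =
    ≤-trans (∑-mono indicator-bound) (≤-reflexive (∑-distrib-+ (λ i → 𝟙 (P? i)) (λ i → 𝟙 (Q? i))))
    where
    indicator-bound : ∀ i → 𝟙 (R? i) ≤ 𝟙 (P? i) + 𝟙 (Q? i)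
    indicator-bound i with R? i
    ... | no _  = z≤n
    ... | yes ri with R⇒P⊎Q ri
    ...   | inj₁ pi = ≤-trans (𝟙-mono (yes ri) (P? i) (λ _ → pi)) (m≤m+n _ _)
    ...   | inj₂ qi = ≤-trans (𝟙-mono (yes ri) (Q? i) (λ _ → qi)) (m≤n+m _ _)

module _ {k : ℕ} {p : Level} {P : Fin k → Set p} (P? : ∀ i → Dec (P i)) where

  count-witness : ∀ {i} → P i → 1 ≤ count P?
  count-witness {i} pi = ≤-trans (𝟙-mono (yes pi) (P? i) id) (∑-term (λ j → 𝟙 (P? j)) i)

  count-none : (∀ i → ¬ P i) → count P? ≡ 0
  count-none empty = ≤-antisym (begin
    count P?             ≤⟨ count-mono P? (λ i → no (empty i)) id ⟩
    sum {k} (λ _ → 0)    ≡⟨ sum-replicate-zero k ⟩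
    0                    ∎) z≤n
    where open ≤-Reasoning

count-split : ∀ {k p q} {P : Fin k → Set p} {Q : Fin k → Set q} (P? : ∀ i → Dec (P i)) (Q? : ∀ i → Dec (Q i)) →
  count P? ≡ count (λ i → P? i ×-dec Q? i) + count (λ i → P? i ×-dec ¬? (Q? i))
count-split {P = P} {Q} P? Q? =
  count-partition (λ i → P? i ×-dec Q? i) (λ i → P? i ×-dec ¬? (Q? i)) P? split [ proj₁ , proj₁ ]′ (λ (_ , qi) (_ , ¬qi) → ¬qi qi)
  where
  split : ∀ {i} → P i → (P i × Q i) ⊎ (P i × ¬ Q i)
  split {i} pi with Q? i
  ... | yes qi = inj₁ (pi , qi)
  ... | no ¬qi = inj₂ (pi , ¬qi)

count-atMostOne : ∀ {k p} {P : Fin k → Set p} (P? : ∀ i → Dec (P i)) →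
  (∀ {i j} → P i → P j → i ≡ j) → count P? ≤ 1
count-atMostOne {zero}  P? unique = z≤n
count-atMostOne {suc k} P? unique with P? zero
... | yes p₀ = ≤-reflexive (cong suc (count-none (λ i → P? (suc i)) (λ i pi → zero≢suc (unique p₀ pi))))
  where
  zero≢suc : ∀ {i : Fin k} → zero ≢ suc i
  zero≢suc ()
... | no _   = count-atMostOne (λ i → P? (suc i)) (λ pi pj → suc-injective (unique pi pj))

count-single : ∀ {k} (a : Fin k) → count (a ≟ᶠ_) ≡ 1
count-single a = ≤-antisym (count-atMostOne (a ≟ᶠ_) (λ a≡i a≡j → trans (sym a≡i) a≡j)) (count-witness (a ≟ᶠ_) refl)

∣∣≡count : ∀ {k} (S : Subset k) → ∣ S ∣ ≡ count (_∈? S)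
∣∣≡count []           = refl
∣∣≡count (inside ∷ S)  = cong suc (trans (∣∣≡count S) (count-cong (_∈? S) (λ i → suc i ∈? inside ∷ S) there (λ { (there i∈S) → i∈S })))
∣∣≡count (outside ∷ S) = trans (∣∣≡count S) (count-cong (_∈? S) (λ i → suc i ∈? outside ∷ S) there (λ { (there i∈S) → i∈S }))

size-after-removal : ∀ {t c s j} → t + c ≡ suc s → c ≤ suc j → s ∸ j ≤ t
size-after-removal {t} {c} {s} {j} t+c≡1+s c≤1+j = begin
  suc s ∸ suc j  ≤⟨ ∸-monoʳ-≤ (suc s) c≤1+j ⟩
  suc s ∸ c      ≡⟨ cong (_∸ c) t+c≡1+s ⟨
  t + c ∸ c      ≡⟨ m+n∸n≡m t c ⟩
  t              ∎
  where open ≤-Reasoning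

module _ (G : Graph) where
  open Graph G

  end₁ end₂ : Edge G → Fin n
  end₁ f = proj₁ (ends f)
  end₂ f = proj₂ (ends f)

  Touches : Edge G → Fin n → Set
  Touches f v = end₁ f ≡ v ⊎ end₂ f ≡ v

  touches? : ∀ f v → Dec (Touches f v)
  touches? f v = (end₁ f ≟ᶠ v) ⊎-dec (end₂ f ≟ᶠ v)

  shares? : ∀ e f → Dec (Shares G e f)
  shares? e f = (end₁ e ≟ᶠ end₁ f) ⊎-dec (end₁ e ≟ᶠ end₂ f) ⊎-dec (end₂ e ≟ᶠ end₁ f) ⊎-dec (end₂ e ≟ᶠ end₂ f)

  shares⇒touches : ∀ {e f} → Shares G e f → Touches f (end₁ e) ⊎ Touches f (end₂ e)
  shares⇒touches (inj₁ p)                = inj₁ (inj₁ (sym p))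
  shares⇒touches (inj₂ (inj₁ p))         = inj₁ (inj₂ (sym p))
  shares⇒touches (inj₂ (inj₂ (inj₁ p)))  = inj₂ (inj₁ (sym p))
  shares⇒touches (inj₂ (inj₂ (inj₂ p)))  = inj₂ (inj₂ (sym p))

  touches⇒shares : ∀ {e f v} → Touches e v → Touches f v → Shares G e f
  touches⇒shares (inj₁ p) (inj₁ q) = inj₁ (trans p (sym q))
  touches⇒shares (inj₁ p) (inj₂ q) = inj₂ (inj₁ (trans p (sym q)))
  touches⇒shares (inj₂ p) (inj₁ q) = inj₂ (inj₂ (inj₁ (trans p (sym q))))
  touches⇒shares (inj₂ p) (inj₂ q) = inj₂ (inj₂ (inj₂ (trans p (sym q))))

  shares-sym : ∀ {e f} → Shares G e f → Shares G f e
  shares-sym (inj₁ p)                = inj₁ (sym p)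
  shares-sym (inj₂ (inj₁ p))         = inj₂ (inj₂ (inj₁ (sym p)))
  shares-sym (inj₂ (inj₂ (inj₁ p)))  = inj₂ (inj₁ (sym p))
  shares-sym (inj₂ (inj₂ (inj₂ p)))  = inj₂ (inj₂ (inj₂ (sym p)))

  degree-of-edge : ∀ f → count (touches? f) ≡ 2
  degree-of-edge f = begin
    count (touches? f)                              ≡⟨ count-partition (end₁ f ≟ᶠ_) (end₂ f ≟ᶠ_) (touches? f) (λ t → t) (λ t → t) distinct ⟩
    count (end₁ f ≟ᶠ_) + count (end₂ f ≟ᶠ_)         ≡⟨ cong₂ _+_ (count-single (end₁ f)) (count-single (end₂ f)) ⟩
    2                                               ∎
    where
    open ≡-Reasoning
    distinct : ∀ {v} → end₁ f ≡ v → ¬ end₂ f ≡ v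
    distinct p q = loopless f (trans p (sym q))

  -- Double counting of incident pairs (edge, vertex): each edge counted
  -- by P is counted once at each of its two endpoints.
  handshake : ∀ {p} {P : Edge G → Set p} (P? : ∀ f → Dec (P f)) →
    2 * count P? ≡ sum (λ v → count (λ f → P? f ×-dec touches? f v))
  handshake P? = begin
    2 * count P?                                              ≡⟨ *-distribˡ-sum 2 (λ f → 𝟙 (P? f)) ⟩
    sum (λ f → 2 * 𝟙 (P? f))                                   ≡⟨ sum-cong-≗ endpoints ⟩
    sum (λ f → count (λ v → P? f ×-dec touches? f v))          ≡⟨ ∑-comm (λ f v → 𝟙 (P? f ×-dec touches? f v)) ⟩
    sum (λ v → count (λ f → P? f ×-dec touches? f v))          ∎
    where
    open ≡-Reasoning
    endpoints : ∀ f → 2 * 𝟙 (P? f) ≡ count (λ v → P? f ×-dec touches? f v)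
    endpoints f with P? f
    ... | yes pf = sym (trans (count-cong (λ v → yes pf ×-dec touches? f v) (touches? f) proj₂ (pf ,_)) (degree-of-edge f))
    ... | no ¬pf = sym (count-none (λ v → no ¬pf ×-dec touches? f v) (λ v → ¬pf ∘ proj₁))

  matching-unique : ∀ {S} → IsMatching G S → ∀ {f g v} → f ∈ S → g ∈ S → Touches f v → Touches g v → f ≡ g
  matching-unique matchS {f} {g} f∈S g∈S tf tg with f ≟ᶠ g
  ... | yes f≡g = f≡g
  ... | no f≢g  = ⊥-elim (matchS f g f∈S g∈S f≢g (touches⇒shares tf tg))

  matching-degree : ∀ {S} → IsMatching G S → ∀ v → count (λ f → (f ∈? S) ×-dec touches? f v) ≤ 1
  matching-degree {S} matchS v = count-atMostOne (λ f → (f ∈? S) ×-dec touches? f v)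
    (λ (f∈S , tf) (g∈S , tg) → matching-unique matchS f∈S g∈S tf tg)

  avoids-end₁ : ∀ {e f} → Shares G e f → ¬ Touches f (end₁ e) → Touches f (end₂ e)
  avoids-end₁ e~f ¬t with shares⇒touches e~f
  ... | inj₁ t = ⊥-elim (¬t t)
  ... | inj₂ t = t

  avoids-end₂ : ∀ {e f} → Shares G e f → ¬ Touches f (end₂ e) → Touches f (end₁ e)
  avoids-end₂ e~f ¬t with shares⇒touches e~f
  ... | inj₁ t = t
  ... | inj₂ t = ⊥-elim (¬t t)

  -- If an endpoint v of e is not covered by the matching S, then every edge
  -- of S sharing an endpoint with e covers the other endpoint, so e is good.
  uncovered⇒good : ∀ {S e v} → IsMatching G S → Touches e v → (∀ {f} → f ∈ S → ¬ Touches f v) → Good G S e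
  uncovered⇒good matchS (inj₁ refl) uncovered f g f∈S g∈S e~f e~g =
    matching-unique matchS f∈S g∈S (avoids-end₁ e~f (uncovered f∈S)) (avoids-end₁ e~g (uncovered g∈S))
  uncovered⇒good matchS (inj₂ refl) uncovered f g f∈S g∈S e~f e~g =
    matching-unique matchS f∈S g∈S (avoids-end₂ e~f (uncovered f∈S)) (avoids-end₂ e~g (uncovered g∈S))

  AllBad : EdgeSet G → EdgeSet G → Set
  AllBad M' S = ∀ g → g ∈ M' → g ∉ S → ¬ Good G S g

  module _ {M' S : EdgeSet G} (matchM' : IsMatching G M') (matchS : IsMatching G S) (allBad : AllBad M' S) where

    new? : ∀ f → Dec (f ∈ M' × f ∉ S)
    new? f = (f ∈? M') ×-dec ¬? (f ∈? S)

    old? : ∀ f → Dec (f ∈ S × f ∉ M')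
    old? f = (f ∈? S) ×-dec ¬? (f ∈? M')

    -- A bad edge g of M' ∖ S has both endpoints covered by S, and the
    -- covering edges lie outside M' because they meet g ∈ M'.
    covered-by-old : ∀ {g v} → g ∈ M' → g ∉ S → Touches g v → ∃[ h ] ((h ∈ S × h ∉ M') × Touches h v)
    covered-by-old {g} {v} g∈M' g∉S tg with any? (λ h → (h ∈? S) ×-dec touches? h v)
    ... | yes (h , h∈S , th) = h , (h∈S , h∉M') , th
      where
      h∉M' : h ∉ M'
      h∉M' h∈M' = g∉S (subst (_∈ S) (matching-unique matchM' h∈M' g∈M' th tg) h∈S)
    ... | no uncovered = ⊥-elim (allBad g g∈M' g∉S (uncovered⇒good matchS tg (λ f∈S tf → uncovered (_ , f∈S , tf))))

    -- At each vertex, M' ∖ S has at most one incident edge, and if it has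
    -- one then so does S ∖ M'.
    new≤old-at : ∀ v → count (λ f → new? f ×-dec touches? f v) ≤ count (λ f → old? f ×-dec touches? f v)
    new≤old-at v with any? (λ f → new? f ×-dec touches? f v)
    ... | no none = ≤-trans (≤-reflexive (count-none (λ f → new? f ×-dec touches? f v) (λ f p → none (f , p)))) z≤n
    ... | yes (g , (g∈M' , g∉S) , tg) with covered-by-old g∈M' g∉S tg
    ...   | h , old-h , th = ≤-trans at-most-one (count-witness (λ f → old? f ×-dec touches? f v) (old-h , th))
      where
      at-most-one : count (λ f → new? f ×-dec touches? f v) ≤ 1
      at-most-one = count-atMostOne (λ f → new? f ×-dec touches? f v)
        (λ ((f∈M' , _) , tf) ((f′∈M' , _) , tf′) → matching-unique matchM' f∈M' f′∈M' tf tf′)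

    new≤old : count new? ≤ count old?
    new≤old = *-cancelˡ-≤ 2 (begin
      2 * count new?                                             ≡⟨ handshake new? ⟩
      sum (λ v → count (λ f → new? f ×-dec touches? f v))        ≤⟨ ∑-mono new≤old-at ⟩
      sum (λ v → count (λ f → old? f ×-dec touches? f v))        ≡⟨ handshake old? ⟨
      2 * count old?                                             ∎)
      where open ≤-Reasoning

    allBad⇒size≤ : ∣ M' ∣ ≤ ∣ S ∣
    allBad⇒size≤ = begin
      ∣ M' ∣                                                                ≡⟨ ∣∣≡count M' ⟩
      count (_∈? M')                                                        ≡⟨ count-split (_∈? M') (_∈? S) ⟩
      count (λ f → (f ∈? M') ×-dec (f ∈? S)) + count new?                   ≤⟨ +-mono-≤ (≤-reflexive common) new≤old ⟩
      count (λ f → (f ∈? S) ×-dec (f ∈? M')) + count old?                   ≡⟨ count-split (_∈? S) (_∈? M') ⟨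
      count (_∈? S)                                                         ≡⟨ ∣∣≡count S ⟨
      ∣ S ∣                                                                 ∎
      where
      open ≤-Reasoning
      common : count (λ f → (f ∈? M') ×-dec (f ∈? S)) ≡ count (λ f → (f ∈? S) ×-dec (f ∈? M'))
      common = count-cong (λ f → (f ∈? M') ×-dec (f ∈? S)) (λ f → (f ∈? S) ×-dec (f ∈? M')) swap swap

  conflicts? : (S : EdgeSet G) (e : Edge G) → ∀ f → Dec (f ∈ S × Shares G e f)
  conflicts? S e f = (f ∈? S) ×-dec shares? e f

  Inserted : EdgeSet G → Edge G → EdgeSet G → Set
  Inserted S e T = ∀ f → f ∈ T ⇔ (f ≡ e ⊎ (f ∈ S × (Shares G e f → ⊥)))

  module _ {S T : EdgeSet G} {e : Edge G} (e∉S : e ∉ S) (T-spec : Inserted S e T) where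

    -- T and the conflicts of e partition S ∪ {e}, so |T| + c = |S| + 1.
    inserted-size : ∣ T ∣ + count (conflicts? S e) ≡ suc ∣ S ∣
    inserted-size = begin
      ∣ T ∣ + count (conflicts? S e)        ≡⟨ cong (_+ count (conflicts? S e)) (∣∣≡count T) ⟩
      count (_∈? T) + count (conflicts? S e) ≡⟨ count-partition (_∈? T) (conflicts? S e) S∪e? to-parts from-parts disjoint ⟨
      count S∪e?                           ≡⟨ count-partition (e ≟ᶠ_) (_∈? S) S∪e? id id (λ { refl → e∉S }) ⟩
      count (e ≟ᶠ_) + count (_∈? S)          ≡⟨ cong₂ _+_ (count-single e) (sym (∣∣≡count S)) ⟩
      suc ∣ S ∣                               ∎
      where
      open ≡-Reasoning
      S∪e? : ∀ f → Dec (e ≡ f ⊎ f ∈ S)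
      S∪e? f = (e ≟ᶠ f) ⊎-dec (f ∈? S)
      to-parts : ∀ {f} → e ≡ f ⊎ f ∈ S → f ∈ T ⊎ (f ∈ S × Shares G e f)
      to-parts (inj₁ refl) = inj₁ (Equivalence.from (T-spec e) (inj₁ refl))
      to-parts {f} (inj₂ f∈S) with shares? e f
      ... | yes e~f = inj₂ (f∈S , e~f)
      ... | no ¬e~f = inj₁ (Equivalence.from (T-spec f) (inj₂ (f∈S , ¬e~f)))
      from-parts : ∀ {f} → f ∈ T ⊎ (f ∈ S × Shares G e f) → e ≡ f ⊎ f ∈ S
      from-parts {f} (inj₁ f∈T) with Equivalence.to (T-spec f) f∈T
      ... | inj₁ f≡e       = inj₁ (sym f≡e)
      ... | inj₂ (f∈S , _) = inj₂ f∈S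
      from-parts (inj₂ (f∈S , _)) = inj₂ f∈S
      disjoint : ∀ {f} → f ∈ T → ¬ (f ∈ S × Shares G e f)
      disjoint {f} f∈T (f∈S , e~f) with Equivalence.to (T-spec f) f∈T
      ... | inj₁ refl       = e∉S f∈S
      ... | inj₂ (_ , ¬e~f) = ¬e~f e~f

  -- Each endpoint of e meets at most one edge of the matching S,
  -- so e has at most two conflicts.
  conflicts≤2 : ∀ {S} → IsMatching G S → ∀ e → count (conflicts? S e) ≤ 2
  conflicts≤2 {S} matchS e = ≤-trans
    (count-subadditive (at (end₁ e)) (at (end₂ e)) (conflicts? S e) (λ (f∈S , e~f) → ⊎-map (f∈S ,_) (f∈S ,_) (shares⇒touches e~f)))
    (+-mono-≤ (matching-degree matchS (end₁ e)) (matching-degree matchS (end₂ e)))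
    where
    at : ∀ v f → Dec (f ∈ S × Touches f v)
    at v f = (f ∈? S) ×-dec touches? f v

  good⇒conflicts≤1 : ∀ {S e} → Good G S e → count (conflicts? S e) ≤ 1
  good⇒conflicts≤1 {S} {e} good = count-atMostOne (conflicts? S e) (λ (f∈S , e~f) (g∈S , e~g) → good _ _ f∈S g∈S e~f e~g)

  inserted-matching : ∀ {S T e} → IsMatching G S → Inserted S e T → IsMatching G T
  inserted-matching {S} {T} {e} matchS T-spec f g f∈T g∈T f≢g f~g
    with Equivalence.to (T-spec f) f∈T | Equivalence.to (T-spec g) g∈T
  ... | inj₁ refl        | inj₁ refl        = f≢g refl
  ... | inj₁ refl        | inj₂ (_ , ¬e~g)  = ¬e~g f~g
  ... | inj₂ (_ , ¬e~f)  | inj₁ refl        = ¬e~f (shares-sym f~g)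
  ... | inj₂ (f∈S , _)   | inj₂ (g∈S , _)   = matchS f g f∈S g∈S f≢g f~g

  step-matching : ∀ {M' S T} → IsMatching G S → Step G M' S T → IsMatching G T
  step-matching matchS (_ , _ , _ , _ , T-spec) = inserted-matching matchS T-spec

  -- A step either does not shrink S, or it inserts a bad edge; then by the
  -- choice rule all of M' ∖ S is bad, so |S| ≥ |M'| and |T| = |S| - 1 ≥ |M'| - 1.
  step-size : ∀ {M' S T} → IsMatching G M' → IsMatching G S → Step G M' S T → ∣ S ∣ ≤ ∣ T ∣ ⊎ ∣ M' ∣ ∸ 1 ≤ ∣ T ∣
  step-size {M'} {S} matchM' matchS (e , _ , e∉S , good-first , T-spec) with count (conflicts? S e) ≤? 1
  ... | yes c≤1 = inj₁ (size-after-removal (inserted-size e∉S T-spec) c≤1)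
  ... | no c≰1  = inj₂ (≤-trans (∸-monoˡ-≤ 1 (allBad⇒size≤ matchM' matchS allBad))
                                (size-after-removal (inserted-size e∉S T-spec) (conflicts≤2 matchS e)))
    where
    allBad : AllBad M' S
    allBad g g∈M' g∉S good = c≰1 (good⇒conflicts≤1 (good-first (g , g∈M' , g∉S , good)))

lemma3p2 : (G : Graph) (M M' : EdgeSet G) → IsMatching G M → IsMatching G M' →
    (S : EdgeSet G) → Reachable G M' M S → ∣ S ∣ ≥ ∣ M ∣ ⊓ (∣ M' ∣ ∸ 1)
lemma3p2 G M M' matchM matchM' S reach = proj₂ (along reach (matchM , m⊓n≤m _ _))
  where
  Invariant : EdgeSet G → Set
  Invariant X = IsMatching G X × ∣ M ∣ ⊓ (∣ M' ∣ ∸ 1) ≤ ∣ X ∣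

  preserved : ∀ {X Y} → Step G M' X Y → Invariant X → Invariant Y
  preserved step (matchX , bound≤X) =
    step-matching G matchX step ,
    [ ≤-trans bound≤X , ≤-trans (m⊓n≤n _ _) ]′ (step-size G matchM' matchX step)

  along : ∀ {X Y} → Star (Step G M') X Y → Invariant X → Invariant Y
  along ε              inv = inv
  along (step ◅ steps) inv = along steps (preserved step inv)
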